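{- Let $F$ be a face of a triangulation $\Gamma$ and $M_F$ its $z$-monodromy. Then: (1) $M_F(e)=e'$ implies $M_F(-e')=-e$; (2) $M_F$ is bijective; (3) $M_F(e)\ne -e$ for every $e\in\Omega(F)$; (4) every cycle of the permutation $M_F$ has length at most $3$.
   Context: A triangulation is a connected simple finite graph embedded in a connected closed $2$-dimensional surface such that every face (closure of a component of the complement) is a closed $2$-disc with exactly three edges, every edge lies in exactly two distinct faces, and two distinct faces meet in an edge, a vertex, or not at all. Two distinct edges are adjacent if they share a vertex and lie in a common face. A zigzag is a sequence of edges $(e_i)_{i\in\mathbb N}$ with $e_i,e_{i+1}$ adjacent and the face containing $e_i,e_{i+1}$ distinct from the face containing $e_{i+1},e_{i+2}$, for all $i$; it is periodic and regarded as a cyclic sequence; written as a cyclic sequence of vertices, each passage through an edge has a direction (oriented edge). A zigzag is determined by any two consecutive oriented edges; its reverse is a zigzag. For a face $F$ with vertices $a,b,c$, $\Omega(F)=\{ab,bc,ca,ac,cb,ba\}$ (oriented edges), $-e$ is the reverse of $e$, and $D_F=(ab,bc,ca)(ac,cb,ba)$. The $z$-monodromy $M_F:\Omega(F)\to\Omega(F)$: for $e\in\Omega(F)$ take $e_0$ with $D_F(e_0)=e$ and the zigzag $Z$ containing consecutive oriented edges $e_0,e$; $M_F(e)$ is the first element of $\Omega(F)$ occurring in $Z$ after $e$. -}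

module Defs where

open import Data.Nat using (ℕ; zero; suc; _<_; _≤_)
open import Data.Fin using (Fin)
open import Data.Product using (Σ; ∃; ∃-syntax; _×_; _,_)
open import Data.Sum using (_⊎_)
open import Relation.Nullary using (¬_)
open import Relation.Binary.PropositionalEquality using (_≡_; _≢_)
open import Relation.Binary.Construct.Closure.ReflexiveTransitive using (Star)

-- Faces are determined by their vertex sets
-- (two distinct faces never share all three vertices, since they meet in
-- an edge, a vertex or not at all), so a face is recorded by the predicate
-- Face a b c, closed under permutations of a b c.

record Triangulation : Set₁ where
  field
    n    : ℕ
    Face : Fin n → Fin n → Fin n → Set
    face-distinct : ∀ {a b c} → Face a b c → a ≢ b × b ≢ c × a ≢ c
    face-rot  : ∀ {a b c} → Face a b c → Face b c a
    face-swap : ∀ {a b c} → Face a b c → Face b a c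
    edge-two : ∀ {a b c} → Face a b c →
               Σ (Fin n) λ d → Face a b d × c ≢ d ×
                 (∀ x → Face a b x → x ≡ c ⊎ x ≡ d)
    vertex-covered : ∀ v → ∃[ x ] ∃[ y ] Face v x y
    -- closed surface: the link of every vertex is a single cycle
    -- (the link is 2-regular by edge-two; we require it connected)
    link-connected : ∀ v x y → (∃[ p ] Face v x p) → (∃[ q ] Face v y q) →
                     Star (λ s t → Face v s t) x y
    connected : ∀ u v → Star (λ s t → ∃[ r ] Face s t r) u v

module _ (T : Triangulation) where
  open Triangulation T

  OEdge : Set
  OEdge = Fin n × Fin n

  rev : OEdge → OEdge
  rev (x , y) = (y , x)

  _∈Ω[_,_,_] : OEdge → Fin n → Fin n → Fin n → Set
  e ∈Ω[ a , b , c ] =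
    e ≡ (a , b) ⊎ e ≡ (b , c) ⊎ e ≡ (c , a) ⊎
    e ≡ (a , c) ⊎ e ≡ (c , b) ⊎ e ≡ (b , a)

  DF : Fin n → Fin n → Fin n → OEdge → OEdge → Set
  DF a b c e₀ e =
    (e₀ ≡ (a , b) × e ≡ (b , c)) ⊎ (e₀ ≡ (b , c) × e ≡ (c , a)) ⊎
    (e₀ ≡ (c , a) × e ≡ (a , b)) ⊎ (e₀ ≡ (a , c) × e ≡ (c , b)) ⊎
    (e₀ ≡ (c , b) × e ≡ (b , a)) ⊎ (e₀ ≡ (b , a) × e ≡ (a , c))

  -- A zigzag written as a sequence of vertices w 0, w 1, ...; its i-th
  -- oriented edge is (w i , w (i+1)).  Consecutive edges e_i, e_{i+1}
  -- are adjacent (lie in the face {w i, w (i+1), w (i+2)}) and the face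
  -- containing e_i,e_{i+1} differs from that containing e_{i+1},e_{i+2}.
  IsZigzag : (ℕ → Fin n) → Set
  IsZigzag w = ∀ i → Face (w i) (w (suc i)) (w (suc (suc i))) ×
                     w i ≢ w (suc (suc (suc i)))

  edgeAt : (ℕ → Fin n) → ℕ → OEdge
  edgeAt w i = (w i , w (suc i))

  -- z-monodromy of the face F = {a,b,c}, as a relation:
  -- MF a b c e e'  iff  e ∈ Ω(F) and M_F(e) = e'.
  -- Take e₀ with D_F(e₀) = e and the zigzag w with consecutive oriented
  -- edges e₀ = edge 0, e = edge 1; e' is the first element of Ω(F)
  -- among edge 2, edge 3, ...
  MF : Fin n → Fin n → Fin n → OEdge → OEdge → Set
  MF a b c e e' =
    e ∈Ω[ a , b , c ] ×
    Σ OEdge λ e₀ → DF a b c e₀ e ×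
    Σ (ℕ → Fin n) λ w → IsZigzag w × edgeAt w 0 ≡ e₀ × edgeAt w 1 ≡ e ×
    Σ ℕ λ m → edgeAt w (suc (suc m)) ≡ e' × e' ∈Ω[ a , b , c ] ×
      (∀ j → j < m → ¬ (edgeAt w (suc (suc j)) ∈Ω[ a , b , c ]))

  MFIter : Fin n → Fin n → Fin n → ℕ → OEdge → OEdge → Set
  MFIter a b c zero    e e'' = e ≡ e''
  MFIter a b c (suc k) e e'' = Σ OEdge λ e' → MF a b c e e' × MFIter a b c k e' e''

Fin' : Triangulation → Set
Fin' T = Fin (Triangulation.n T)

module Submission where

-- The zigzag defining M_F(e) leaves F along e = D_F(e₀), wanders
-- outside Ω(F), returns along e' = M_F(e) and then, inside F, continues along
-- D_F(e').  Read backwards, this piece of zigzag leaves F along -e' and first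
-- returns along -e; this gives (1).  If e' = -e the piece would be a
-- palindrome, and a zigzag cannot be its own mirror image; this gives (3).
-- Functionality follows from the fact that a zigzag is determined by two
-- consecutive edges, totality from periodicity of zigzags (pigeonhole), and
-- bijectivity (2) from (1).  Finally (4) is a statement about any map f of
-- the six arcs with f ∘ rev ∘ f = rev and f e ≠ -e: by pigeonhole two of
-- e, f e, f² e, f³ e lie on the same side of F, which forces a cycle of
-- length ≤ 3.

open import Defs
open import Data.Nat using (ℕ; _≤_)
open import Data.Product using (Σ; ∃; ∃-syntax; _×_; _,_)
open import Relation.Binary.PropositionalEquality using (_≡_; _≢_)

open import Data.Nat using (zero; suc; _+_; _*_; _<_; z≤n; s≤s)
open import Data.Nat.Properties
  using (+-suc; +-comm; +-assoc; +-identityʳ; n<1+n; m<n+m; <-cmp; m≤n⇒∃[o]m+o≡n; m<1+n⇒m<n∨m≡n)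
open import Data.Nat.Tactic.RingSolver using (solve-∀)
open import Data.Fin using (Fin; toℕ; combine) renaming (_<_ to _<ᶠ_)
open import Data.Fin.Patterns using (0F; 1F; 2F; 3F)
open import Data.Fin.Properties using (pigeonhole; combine-injective; _≟_)
open import Data.Product using (proj₁; proj₂)
open import Data.Product.Properties using (≡-dec; ,-injectiveˡ; ,-injectiveʳ)
open import Data.Sum using (_⊎_; inj₁; inj₂; [_,_])
open import Data.Empty using (⊥; ⊥-elim)
open import Function using (_∘_; id)
open import Relation.Nullary using (¬_; Dec; yes; no)
open import Relation.Nullary.Decidable using (_⊎-dec_)
open import Relation.Binary using (Tri; tri<; tri≈; tri>)
open import Relation.Binary.PropositionalEquality using (refl; sym; trans; cong; cong₂; subst; subst₂; module ≡-Reasoning)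

least-witness : {Q : ℕ → Set} → (∀ k → Dec (Q k)) → ∀ K → Q K →
                Σ ℕ λ m → Q m × (∀ j → j < m → ¬ Q j)
least-witness {Q} Q? K qK = [ (λ none → K , qK , none) , id ] (search K)
  where
    search : ∀ K → (∀ j → j < K → ¬ Q j) ⊎ (Σ ℕ λ m → Q m × (∀ j → j < m → ¬ Q j))
    search zero = inj₁ λ j ()
    search (suc K) with search K
    ... | inj₂ least = inj₂ least
    ... | inj₁ none with Q? K
    ...   | yes q  = inj₂ (K , q , none)
    ...   | no ¬qK = inj₁ λ j j<1+K → [ none j , (λ { refl → ¬qK }) ] (m<1+n⇒m<n∨m≡n j<1+K)

module ShortCycles {X : Set} (r : X → X) (r-involutive : ∀ x → r (r x) ≡ x)
                   (r-no-fixed : ∀ x → r x ≢ x)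
                   (side : X → Fin 3) (side-fibre : ∀ x y → side x ≡ side y → x ≡ y ⊎ x ≡ r y)
                   (f : X → X) (f-r-f : ∀ x → f (r (f x)) ≡ r x) (f-not-r : ∀ x → f x ≢ r x) where

  f-injective : ∀ {x y} → f x ≡ f y → x ≡ y
  f-injective {x} {y} fx≡fy = begin
    x               ≡⟨ sym (r-involutive x) ⟩
    r (r x)         ≡⟨ cong r (sym (f-r-f x)) ⟩
    r (f (r (f x))) ≡⟨ cong (r ∘ f ∘ r) fx≡fy ⟩
    r (f (r (f y))) ≡⟨ cong r (f-r-f y) ⟩
    r (r y)         ≡⟨ r-involutive y ⟩
    y               ∎
    where open ≡-Reasoning

  -- the three ways in which a point could be the reverse of a later point of its orbit
  not-r-f : ∀ y → y ≢ r (f y)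
  not-r-f y y≡rfy = f-not-r y (sym (trans (cong r y≡rfy) (r-involutive (f y))))

  not-r-f² : ∀ y → y ≢ r (f (f y))
  not-r-f² y y≡rffy = r-no-fixed (f y) (sym (trans (cong f y≡rffy) (f-r-f (f y))))

  not-r-f³ : ∀ y → y ≢ r (f (f (f y)))
  not-r-f³ y y≡rfffy = not-r-f (f y) (trans (cong f y≡rfffy) (f-r-f (f (f y))))

  Cycle : X → Set
  Cycle x = f x ≡ x ⊎ f (f x) ≡ x ⊎ f (f (f x)) ≡ x

  -- four orbit points on three sides: pigeonhole yields two on the same side
  short-cycle : ∀ x → Cycle x
  short-cycle x = settle-pair (pigeonhole (n<1+n 3) side-of-orbit)
    where
      orbit : Fin 4 → X
      orbit 0F = x
      orbit 1F = f x
      orbit 2F = f (f x)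
      orbit 3F = f (f (f x))

      side-of-orbit : Fin 4 → Fin 3
      side-of-orbit = side ∘ orbit

      settle : ∀ i j → (orbit i ≡ orbit j → Cycle x) → orbit i ≢ r (orbit j) →
               side-of-orbit i ≡ side-of-orbit j → Cycle x
      settle i j equal not-reverse same-side =
        [ equal , ⊥-elim ∘ not-reverse ] (side-fibre (orbit i) (orbit j) same-side)

      settle-pair : ∃[ i ] ∃[ j ] (i <ᶠ j × side-of-orbit i ≡ side-of-orbit j) → Cycle x
      settle-pair (0F , 1F , _ , q) = settle 0F 1F (inj₁ ∘ sym) (not-r-f x) q
      settle-pair (0F , 2F , _ , q) = settle 0F 2F (inj₂ ∘ inj₁ ∘ sym) (not-r-f² x) q
      settle-pair (0F , 3F , _ , q) = settle 0F 3F (inj₂ ∘ inj₂ ∘ sym) (not-r-f³ x) q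
      settle-pair (1F , 2F , _ , q) = settle 1F 2F (inj₁ ∘ sym ∘ f-injective) (not-r-f (f x)) q
      settle-pair (1F , 3F , _ , q) = settle 1F 3F (inj₂ ∘ inj₁ ∘ sym ∘ f-injective) (not-r-f² (f x)) q
      settle-pair (2F , 3F , _ , q) = settle 2F 3F (inj₁ ∘ sym ∘ f-injective ∘ f-injective) (not-r-f (f (f x))) q
      settle-pair (0F , 0F , () , _)
      settle-pair (1F , 0F , () , _)
      settle-pair (1F , 1F , s≤s () , _)
      settle-pair (2F , 0F , () , _)
      settle-pair (2F , 1F , s≤s () , _)
      settle-pair (2F , 2F , s≤s (s≤s ()) , _)
      settle-pair (3F , 0F , () , _)
      settle-pair (3F , 1F , s≤s () , _)
      settle-pair (3F , 2F , s≤s (s≤s ()) , _)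
      settle-pair (3F , 3F , s≤s (s≤s (s≤s ())) , _)

module Zigzags (T : Triangulation) where
  open Triangulation T

  V : Set
  V = Fin n

  Face-resp : ∀ {x y z x' y' z'} → x ≡ x' → y ≡ y' → z ≡ z' → Face x y z → Face x' y' z'
  Face-resp refl refl refl xyz = xyz

  -- An edge pq of the face pqr lies in exactly one further face, so all
  -- third vertices of pq other than r coincide.
  other-third-unique : ∀ {p q r x y} → Face p q r → Face p q x → Face p q y →
                       x ≢ r → y ≢ r → x ≡ y
  other-third-unique pqr pqx pqy x≢r y≢r with edge-two pqr
  ... | d , _ , _ , only-thirds with only-thirds _ pqx | only-thirds _ pqy
  ... | inj₁ x≡r | _        = ⊥-elim (x≢r x≡r)
  ... | inj₂ _   | inj₁ y≡r = ⊥-elim (y≢r y≡r)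
  ... | inj₂ x≡d | inj₂ y≡d = trans x≡d (sym y≡d)

  shift-zigzag : ∀ {w} → IsZigzag T w → ∀ d → IsZigzag T (λ t → w (t + d))
  shift-zigzag zw d t = zw (t + d)

  Agree : (ℕ → V) → (ℕ → V) → ℕ → ℕ → Set
  Agree u v i j = u i ≡ v j × u (suc i) ≡ v (suc j) × u (suc (suc i)) ≡ v (suc (suc j))

  -- Determinism: the vertices before and after the edge u(1+i) u(2+i) of a
  -- zigzag are the two distinct third vertices of that edge, so three
  -- consecutive vertices determine the zigzag in both directions.
  module _ {u v : ℕ → V} (zu : IsZigzag T u) (zv : IsZigzag T v) where
    agree-forward : ∀ {i j} → Agree u v i j → Agree u v (suc i) (suc j)
    agree-forward {i} {j} (e₀ , e₁ , e₂) =
      e₁ , e₂ ,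
      other-third-unique (face-rot (proj₁ (zu i))) (proj₁ (zu (suc i)))
        (Face-resp (sym e₁) (sym e₂) refl (proj₁ (zv (suc j))))
        (λ eq → proj₂ (zu i) (sym eq))
        (λ eq → proj₂ (zv j) (trans (sym e₀) (sym eq)))

    agree-backward : ∀ {i j} → Agree u v (suc i) (suc j) → Agree u v i j
    agree-backward {i} {j} (e₁ , e₂ , e₃) =
      other-third-unique (proj₁ (zu (suc i))) (face-rot (proj₁ (zu i)))
        (Face-resp (sym e₁) (sym e₂) refl (face-rot (proj₁ (zv j))))
        (proj₂ (zu i))
        (λ eq → proj₂ (zv j) (trans eq e₃)) ,
      e₁ , e₂

    agree-after : Agree u v 0 0 → ∀ t → Agree u v t t
    agree-after start zero    = start
    agree-after start (suc t) = agree-forward (agree-after start t)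

    edges-determine : edgeAt T u 0 ≡ edgeAt T v 0 → edgeAt T u 1 ≡ edgeAt T v 1 → ∀ t → u t ≡ v t
    edges-determine e₀ e₁ t =
      proj₁ (agree-after (,-injectiveˡ e₀ , ,-injectiveʳ e₀ , ,-injectiveʳ e₁) t)

  agree-descend : ∀ {w d} → IsZigzag T w → ∀ i → Agree w w i (i + d) → Agree w w 0 d
  agree-descend zw zero    same = same
  agree-descend zw (suc i) same = agree-descend zw i (agree-backward zw zw same)

  triple-code : (ℕ → V) → ℕ → Fin (n * n * n)
  triple-code w i = combine (combine (w i) (w (suc i))) (w (suc (suc i)))

  triple-code-injective : ∀ w i j → triple-code w i ≡ triple-code w j → Agree w w i j
  triple-code-injective w i j eq with combine-injective _ _ _ _ eq
  ... | e₀₁ , e₂ with combine-injective _ _ _ _ e₀₁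
  ...   | e₀ , e₁ = e₀ , e₁ , e₂

  -- Every zigzag is periodic: some triple of consecutive vertices repeats
  -- (pigeonhole) and determinism propagates the repetition to all times.
  periodic : ∀ {w} → IsZigzag T w → Σ ℕ λ P → ∀ t → w (t + suc P) ≡ w t
  periodic {w} zw with pigeonhole (n<1+n (n * n * n)) (triple-code w ∘ toℕ)
  ... | i , j , i<j , same-code with m≤n⇒∃[o]m+o≡n i<j
  ...   | P , i+1+P≡j = P , λ t → sym (proj₁ (agree-after zw (shift-zigzag zw (suc P)) repeat t))
    where
      repeat : Agree w w 0 (suc P)
      repeat = agree-descend zw (toℕ i)
        (subst (Agree w w (toℕ i)) (trans (sym i+1+P≡j) (sym (+-suc (toℕ i) P)))
          (triple-code-injective w (toℕ i) (toℕ j) same-code))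

  periodic-multiple : ∀ {w : ℕ → V} {p} → (∀ t → w (t + p) ≡ w t) → ∀ t k → w (t + k * p) ≡ w t
  periodic-multiple {w} per t zero = cong w (+-identityʳ t)
  periodic-multiple {w} {p} per t (suc k) = begin
    w (t + (p + k * p)) ≡⟨ cong w (trans (cong (t +_) (+-comm p (k * p))) (sym (+-assoc t (k * p) p))) ⟩
    w (t + k * p + p)   ≡⟨ per (t + k * p) ⟩
    w (t + k * p)       ≡⟨ periodic-multiple per t k ⟩
    w t                 ∎
    where open ≡-Reasoning

  Mirror : (ℕ → V) → (ℕ → V) → ℕ → Set
  Mirror v w L = ∀ k i → k + i ≡ L → v k ≡ w i

  mirror-edge : ∀ {v w L} → Mirror v w L → ∀ k i → suc (k + i) ≡ L →
                edgeAt T v k ≡ rev T (edgeAt T w i)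
  mirror-edge mir k i k+i+1≡L =
    cong₂ _,_ (mir k (suc i) (trans (+-suc k i) k+i+1≡L)) (mir (suc k) i k+i+1≡L)

  private
    rearrange : ∀ L P k t → L + P * k + t * suc P ≡ L + t * suc P + P * k
    rearrange = solve-∀
    collect : ∀ k i P → k + i + P * k ≡ i + k * suc P
    collect = solve-∀
    regroup : ∀ d e k j → d + k + (e + j) ≡ d + e + (k + j)
    regroup = solve-∀
    window : ∀ L P k → 3 + (k + (L + P * (3 + k))) ≡ L + (3 + k) * suc P
    window = solve-∀

  -- Every zigzag has, for every L, a mirror image about L/2 which is again a
  -- zigzag: with period p = 1+P, time k of the mirror image is time L + P k ≡ L - k (mod p).
  reflection : ∀ {w} → IsZigzag T w → ∀ L → Σ (ℕ → V) λ v → IsZigzag T v × Mirror v w L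
  reflection {w} zw L with periodic zw
  ... | P , per = v , v-zigzag , λ k i k+i≡L → v-mirror k i 0 (trans k+i≡L (sym (+-identityʳ L)))
    where
      v : ℕ → V
      v k = w (L + P * k)

      v-mirror : ∀ k i t → k + i ≡ L + t * suc P → v k ≡ w i
      v-mirror k i t k+i≡ = begin
        w (L + P * k)                 ≡⟨ sym (periodic-multiple per (L + P * k) t) ⟩
        w (L + P * k + t * suc P)     ≡⟨ cong w (rearrange L P k t) ⟩
        w (L + t * suc P + P * k)     ≡⟨ cong (λ x → w (x + P * k)) (sym k+i≡) ⟩
        w (k + i + P * k)             ≡⟨ cong w (collect k i P) ⟩
        w (i + k * suc P)             ≡⟨ periodic-multiple per i k ⟩
        w i                           ∎
        where open ≡-Reasoning

      -- the four vertices of v from time k are those of w from time j, in reverse order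
      v-zigzag : IsZigzag T v
      v-zigzag k = Face-resp (sym (at 0 3 refl)) (sym (at 1 2 refl)) (sym (at 2 1 refl))
                     (face-swap (face-rot (proj₁ (zw (suc j))))) ,
                   λ eq → proj₂ (zw j) (sym (trans (sym (at 0 3 refl)) (trans eq (at 3 0 refl))))
        where
          j : ℕ
          j = L + P * (3 + k)
          at : ∀ d e → d + e ≡ 3 → v (d + k) ≡ w (e + j)
          at d e d+e≡3 = v-mirror (d + k) (e + j) (3 + k)
            (trans (regroup d e k j) (trans (cong (_+ (k + j)) d+e≡3) (window L P k)))

  -- No zigzag is its own mirror image: going inwards, the centre of symmetry
  -- would be a vertex equal to its neighbour or a face with two equal vertices.
  no-palindrome : ∀ {w} → IsZigzag T w → ∀ L → Mirror w w (2 + L) → ⊥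
  no-palindrome zw zero          mir = proj₂ (proj₂ (face-distinct (proj₁ (zw 0)))) (mir 0 2 refl)
  no-palindrome zw (suc zero)    mir = proj₁ (proj₂ (face-distinct (proj₁ (zw 0)))) (mir 1 2 refl)
  no-palindrome zw (suc (suc L)) mir =
    no-palindrome (λ t → zw (suc t)) L
      (λ k i k+i≡ → mir (suc k) (suc i) (cong suc (trans (+-suc k i) (cong suc k+i≡))))

  record OrderedFace : Set where
    constructor ordered
    field
      x y z : V
      face  : Face x y z
  open OrderedFace

  cross : OrderedFace → OrderedFace
  cross φ = ordered (y φ) (z φ) (proj₁ beyond) (proj₁ (proj₂ beyond))
    where
      beyond : Σ V λ d → Face (y φ) (z φ) d × x φ ≢ d × (∀ t → Face (y φ) (z φ) t → t ≡ x φ ⊎ t ≡ d)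
      beyond = edge-two (face-rot (face φ))

  crossings : OrderedFace → ℕ → OrderedFace
  crossings φ zero    = φ
  crossings φ (suc k) = cross (crossings φ k)

  zigzag-through : ∀ {p q r} → Face p q r →
                   Σ (ℕ → V) λ w → IsZigzag T w × w 0 ≡ p × w 1 ≡ q × w 2 ≡ r
  zigzag-through {p} {q} {r} pqr = x ∘ crossings start , is-zigzag , refl , refl , refl
    where
      start : OrderedFace
      start = ordered p q r pqr
      is-zigzag : IsZigzag T (x ∘ crossings start)
      is-zigzag k = face (crossings start k) ,
                    proj₁ (proj₂ (proj₂ (edge-two (face-rot (face (crossings start k))))))

module Monodromy (T : Triangulation) (a b c : Fin' T) (abc : Triangulation.Face T a b c) where
  open Triangulation T
  open Zigzags T

  a≢b : a ≢ b
  a≢b = proj₁ (face-distinct abc)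
  b≢c : b ≢ c
  b≢c = proj₁ (proj₂ (face-distinct abc))
  a≢c : a ≢ c
  a≢c = proj₂ (proj₂ (face-distinct abc))

  corner : Fin 3 → V
  corner 0F = a
  corner 1F = b
  corner 2F = c

  corner-injective : ∀ {i j} → corner i ≡ corner j → i ≡ j
  corner-injective {0F} {0F} _ = refl
  corner-injective {0F} {1F} e = ⊥-elim (a≢b e)
  corner-injective {0F} {2F} e = ⊥-elim (a≢c e)
  corner-injective {1F} {0F} e = ⊥-elim (a≢b (sym e))
  corner-injective {1F} {1F} _ = refl
  corner-injective {1F} {2F} e = ⊥-elim (b≢c e)
  corner-injective {2F} {0F} e = ⊥-elim (a≢c (sym e))
  corner-injective {2F} {1F} e = ⊥-elim (b≢c (sym e))
  corner-injective {2F} {2F} _ = refl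

  next : Fin 3 → Fin 3
  next 0F = 1F
  next 1F = 2F
  next 2F = 0F

  next³ : ∀ k → next (next (next k)) ≡ k
  next³ 0F = refl
  next³ 1F = refl
  next³ 2F = refl

  next²-no-fixed : ∀ k → next (next k) ≢ k
  next²-no-fixed 0F ()
  next²-no-fixed 1F ()
  next²-no-fixed 2F ()

  -- The six arcs (oriented edges) of F: side k joins corner k and corner
  -- (next k); k ⁺ runs along the cyclic order, k ⁻ against it.
  data Arc : Set where
    _⁺ _⁻ : Fin 3 → Arc

  edge : Arc → OEdge T
  edge (k ⁺) = corner k , corner (next k)
  edge (k ⁻) = corner (next k) , corner k

  side : Arc → Fin 3
  side (k ⁺) = k
  side (k ⁻) = k

  flip : Arc → Arc
  flip (k ⁺) = k ⁻
  flip (k ⁻) = k ⁺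

  D : Arc → Arc
  D (k ⁺) = next k ⁺
  D (k ⁻) = next (next k) ⁻

  flip-edge : ∀ s → rev T (edge s) ≡ edge (flip s)
  flip-edge (k ⁺) = refl
  flip-edge (k ⁻) = refl

  flip-involutive : ∀ s → flip (flip s) ≡ s
  flip-involutive (k ⁺) = refl
  flip-involutive (k ⁻) = refl

  flip-no-fixed : ∀ s → flip s ≢ s
  flip-no-fixed (k ⁺) ()
  flip-no-fixed (k ⁻) ()

  side-fibre : ∀ s t → side s ≡ side t → s ≡ t ⊎ s ≡ flip t
  side-fibre (k ⁺) (.k ⁺) refl = inj₁ refl
  side-fibre (k ⁺) (.k ⁻) refl = inj₂ refl
  side-fibre (k ⁻) (.k ⁺) refl = inj₂ refl
  side-fibre (k ⁻) (.k ⁻) refl = inj₁ refl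

  edge-injective : ∀ {s t} → edge s ≡ edge t → s ≡ t
  edge-injective {i ⁺} {j ⁺} e = cong _⁺ (corner-injective (,-injectiveˡ e))
  edge-injective {i ⁻} {j ⁻} e = cong _⁻ (corner-injective (,-injectiveʳ e))
  edge-injective {i ⁺} {j ⁻} e = ⊥-elim (next²-no-fixed j
    (trans (cong next (sym (corner-injective (,-injectiveˡ e)))) (corner-injective (,-injectiveʳ e))))
  edge-injective {i ⁻} {j ⁺} e = ⊥-elim (next²-no-fixed j
    (trans (cong next (sym (corner-injective (,-injectiveʳ e)))) (corner-injective (,-injectiveˡ e))))

  D³ : ∀ s → D (D (D s)) ≡ s
  D³ (k ⁺) = cong _⁺ (next³ k)
  D³ (k ⁻) = cong _⁻ (trans (next³ (next (next (next k)))) (next³ k))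

  D-injective : ∀ {s t} → D s ≡ D t → s ≡ t
  D-injective {s} {t} Ds≡Dt = trans (sym (D³ s)) (trans (cong (D ∘ D) Ds≡Dt) (D³ t))

  source-D : ∀ s → proj₁ (edge (D s)) ≡ proj₂ (edge s)
  source-D (k ⁺) = refl
  source-D (k ⁻) = cong corner (next³ k)

  target-D² : ∀ s → proj₂ (edge (D (D s))) ≡ proj₁ (edge s)
  target-D² (k ⁺) = cong corner (next³ k)
  target-D² (k ⁻) = cong corner (next³ (next k))

  D-flip-D : ∀ s → D (flip (D s)) ≡ flip s
  D-flip-D (k ⁺) = cong _⁻ (next³ k)
  D-flip-D (k ⁻) = cong _⁺ (next³ k)

  arc-face : ∀ s → Face (proj₁ (edge s)) (proj₂ (edge s)) (proj₂ (edge (D s)))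
  arc-face (0F ⁺) = abc
  arc-face (1F ⁺) = face-rot abc
  arc-face (2F ⁺) = face-rot (face-rot abc)
  arc-face (0F ⁻) = face-swap abc
  arc-face (1F ⁻) = face-swap (face-rot abc)
  arc-face (2F ⁻) = face-swap (face-rot (face-rot abc))

  Ω : OEdge T → Set
  Ω e = _∈Ω[_,_,_] T e a b c

  arc-of : ∀ {e} → Ω e → Σ Arc λ s → e ≡ edge s
  arc-of (inj₁ e≡)                               = 0F ⁺ , e≡
  arc-of (inj₂ (inj₁ e≡))                        = 1F ⁺ , e≡
  arc-of (inj₂ (inj₂ (inj₁ e≡)))                 = 2F ⁺ , e≡
  arc-of (inj₂ (inj₂ (inj₂ (inj₁ e≡))))          = 2F ⁻ , e≡
  arc-of (inj₂ (inj₂ (inj₂ (inj₂ (inj₁ e≡)))))   = 1F ⁻ , e≡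
  arc-of (inj₂ (inj₂ (inj₂ (inj₂ (inj₂ e≡)))))   = 0F ⁻ , e≡

  arc-in-Ω : ∀ s → Ω (edge s)
  arc-in-Ω (0F ⁺) = inj₁ refl
  arc-in-Ω (1F ⁺) = inj₂ (inj₁ refl)
  arc-in-Ω (2F ⁺) = inj₂ (inj₂ (inj₁ refl))
  arc-in-Ω (2F ⁻) = inj₂ (inj₂ (inj₂ (inj₁ refl)))
  arc-in-Ω (1F ⁻) = inj₂ (inj₂ (inj₂ (inj₂ (inj₁ refl))))
  arc-in-Ω (0F ⁻) = inj₂ (inj₂ (inj₂ (inj₂ (inj₂ refl))))

  in-Ω : ∀ {e s} → e ≡ edge s → Ω e
  in-Ω {s = s} refl = arc-in-Ω s

  Ω-rev : ∀ {e} → Ω e → Ω (rev T e)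
  Ω-rev ω with arc-of ω
  ... | s , refl = in-Ω (flip-edge s)

  Ω? : ∀ e → Dec (Ω e)
  Ω? e = (e ≟ₑ (a , b)) ⊎-dec (e ≟ₑ (b , c)) ⊎-dec (e ≟ₑ (c , a)) ⊎-dec
         (e ≟ₑ (a , c)) ⊎-dec (e ≟ₑ (c , b)) ⊎-dec (e ≟ₑ (b , a))
    where
      _≟ₑ_ : (e e' : OEdge T) → Dec (e ≡ e')
      _≟ₑ_ = ≡-dec _≟_ _≟_

  DF-arc : ∀ {e₀ e} → DF T a b c e₀ e → Σ Arc λ s → e₀ ≡ edge s × e ≡ edge (D s)
  DF-arc (inj₁ e≡)                             = 0F ⁺ , e≡
  DF-arc (inj₂ (inj₁ e≡))                      = 1F ⁺ , e≡
  DF-arc (inj₂ (inj₂ (inj₁ e≡)))               = 2F ⁺ , e≡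
  DF-arc (inj₂ (inj₂ (inj₂ (inj₁ e≡))))        = 2F ⁻ , e≡
  DF-arc (inj₂ (inj₂ (inj₂ (inj₂ (inj₁ e≡))))) = 1F ⁻ , e≡
  DF-arc (inj₂ (inj₂ (inj₂ (inj₂ (inj₂ e≡))))) = 0F ⁻ , e≡

  arc-DF : ∀ s → DF T a b c (edge s) (edge (D s))
  arc-DF (0F ⁺) = inj₁ (refl , refl)
  arc-DF (1F ⁺) = inj₂ (inj₁ (refl , refl))
  arc-DF (2F ⁺) = inj₂ (inj₂ (inj₁ (refl , refl)))
  arc-DF (2F ⁻) = inj₂ (inj₂ (inj₂ (inj₁ (refl , refl))))
  arc-DF (1F ⁻) = inj₂ (inj₂ (inj₂ (inj₂ (inj₁ (refl , refl)))))
  arc-DF (0F ⁻) = inj₂ (inj₂ (inj₂ (inj₂ (inj₂ (refl , refl)))))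

  -- This is exactly the data in M_F(edge (D s₀)) = edge s'.
  record Passage (s₀ s' : Arc) : Set where
    constructor passage
    field
      w       : ℕ → V
      zigzag  : IsZigzag T w
      start₀  : edgeAt T w 0 ≡ edge s₀
      start₁  : edgeAt T w 1 ≡ edge (D s₀)
      m       : ℕ
      return  : edgeAt T w (2 + m) ≡ edge s'
      outside : ∀ j → j < m → ¬ Ω (edgeAt T w (2 + j))

  MF-passage : ∀ {e e'} → MF T a b c e e' →
               Σ Arc λ s₀ → Σ Arc λ s' → e ≡ edge (D s₀) × e' ≡ edge s' × Passage s₀ s'
  MF-passage (_ , _ , df , w , zw , w₀ , w₁ , m , w-return , ω' , outside)
    with DF-arc df | arc-of ω'
  ... | s₀ , e₀≡ , e≡ | s' , e'≡ =
    s₀ , s' , e≡ , e'≡ , passage w zw (trans w₀ e₀≡) (trans w₁ e≡) m (trans w-return e'≡) outside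

  passage-MF : ∀ {s₀ s'} → Passage s₀ s' → MF T a b c (edge (D s₀)) (edge s')
  passage-MF {s₀} {s'} (passage w zw start₀ start₁ m return outside) =
    arc-in-Ω (D s₀) , edge s₀ , arc-DF s₀ , w , zw , start₀ , start₁ , m , return , arc-in-Ω s' , outside

  closing-edge : ∀ {x y} s' → x ≡ proj₂ (edge (D s')) → y ≡ proj₁ (edge s') → (x , y) ≡ edge (D (D s'))
  closing-edge s' x≡ y≡ = cong₂ _,_ (trans x≡ (sym (source-D (D s')))) (trans y≡ (sym (target-D² s')))

  -- The vertex before the return edge is not the third corner of D s': else
  -- edge 1+m would be the arc D (D s'), lying in Ω(F) (if m > 0) or forcing
  -- s₀ = D s' and hence w 0 = w 3 (if m = 0).
  before-return : ∀ {s₀ s'} (p : Passage s₀ s') → Passage.w p (suc (Passage.m p)) ≢ proj₂ (edge (D s'))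
  before-return {s₀} {s'} (passage w zw start₀ start₁ zero return _) w₁≡ = proj₂ (zw 0) w₀≡w₃
    where
      s₀≡Ds' : s₀ ≡ D s'
      s₀≡Ds' = D-injective (edge-injective (trans (sym start₁) (closing-edge s' w₁≡ (,-injectiveˡ return))))
      w₀≡w₃ : w 0 ≡ w 3
      w₀≡w₃ = trans (,-injectiveˡ start₀)
                (trans (cong (proj₁ ∘ edge) s₀≡Ds') (trans (source-D s') (sym (,-injectiveʳ return))))
  before-return {s' = s'} (passage w zw _ _ (suc j) return outside) w₁₊ⱼ≡ =
    outside j (n<1+n j) (in-Ω (closing-edge s' w₁₊ⱼ≡ (,-injectiveˡ return)))

  passage-exit : ∀ {s₀ s'} (p : Passage s₀ s') → edgeAt T (Passage.w p) (3 + Passage.m p) ≡ edge (D s')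
  passage-exit {s' = s'} p@(passage w zw _ _ m return _) =
    cong₂ _,_ (trans (,-injectiveʳ return) (sym (source-D s')))
      (other-third-unique (face-rot (proj₁ (zw (suc m)))) (proj₁ (zw (2 + m)))
        (Face-resp (sym (,-injectiveˡ return)) (sym (,-injectiveʳ return)) refl (arc-face s'))
        (λ eq → proj₂ (zw (suc m)) (sym eq))
        (λ eq → before-return p (sym eq)))

  passage-unique : ∀ {s₀ s' s''} → Passage s₀ s' → Passage s₀ s'' → s' ≡ s''
  passage-unique {s' = s'} {s''} (passage w zw start₀ start₁ m return outside)
                                 (passage w' zw' start₀' start₁' m' return' outside') = compare (<-cmp m m')
    where
      same-edge : ∀ t → edgeAt T w t ≡ edgeAt T w' t
      same-edge t = cong₂ _,_ (same-walk t) (same-walk (suc t))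
        where
          same-walk : ∀ t → w t ≡ w' t
          same-walk = edges-determine zw zw' (trans start₀ (sym start₀')) (trans start₁ (sym start₁'))
      -- the earlier of the two return times would contradict the other passage
      compare : Tri (m < m') (m ≡ m') (m' < m) → s' ≡ s''
      compare (tri< m<m' _ _) = ⊥-elim (outside' m m<m' (in-Ω (trans (sym (same-edge (2 + m))) return)))
      compare (tri≈ _ m≡m' _) = edge-injective
        (trans (sym return) (trans (same-edge (2 + m)) (trans (cong (λ k → edgeAt T w' (2 + k)) m≡m') return')))
      compare (tri> _ _ m'<m) = ⊥-elim (outside m' m'<m (in-Ω (trans (same-edge (2 + m')) return')))

  zigzag-along : ∀ s₀ → Σ (ℕ → V) λ w → IsZigzag T w × edgeAt T w 0 ≡ edge s₀ × edgeAt T w 1 ≡ edge (D s₀)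
  zigzag-along s₀ with zigzag-through (arc-face s₀)
  ... | w , zw , w₀ , w₁ , w₂ = w , zw , cong₂ _,_ w₀ w₁ , cong₂ _,_ (trans w₁ (sym (source-D s₀))) w₂

  -- Every arc starts a passage: the zigzag along s₀, D s₀ is periodic, so it
  -- meets Ω(F) again, and we take the first such time.
  passage-exists : ∀ s₀ → Σ Arc λ s' → Passage s₀ s'
  passage-exists s₀ with zigzag-along s₀
  ... | w , zw , start₀ , start₁ with periodic zw
  ... | P , per with least-witness (λ k → Ω? (edgeAt T w (2 + k))) P
                       (in-Ω (trans (cong₂ _,_ (per 1) (per 2)) start₁))
  ... | m , ω , outside with arc-of ω
  ... | s' , return = s' , passage w zw start₀ start₁ m return outside

  -- Read backwards from time 4+m, a passage p gives a zigzag starting with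
  -- the reversed exit arc flip (D s') followed by flip s' = D (flip (D s')).
  record Reversed {s₀ s'} (p : Passage s₀ s') : Set where
    field
      v        : ℕ → V
      v-zigzag : IsZigzag T v
      mirror   : Mirror v (Passage.w p) (4 + Passage.m p)
      v-start₀ : edgeAt T v 0 ≡ edge (flip (D s'))
      v-start₁ : edgeAt T v 1 ≡ edge (D (flip (D s')))

  reversal : ∀ {s₀ s'} (p : Passage s₀ s') → Reversed p
  reversal {s' = s'} p@(passage w zw _ _ m return _) = record
    { v        = proj₁ mirrored
    ; v-zigzag = proj₁ (proj₂ mirrored)
    ; mirror   = mir
    ; v-start₀ = trans (mirror-edge mir 0 (3 + m) refl)
                   (trans (cong (rev T) (passage-exit p)) (flip-edge (D s')))
    ; v-start₁ = trans (mirror-edge mir 1 (2 + m) refl)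
                   (trans (cong (rev T) return) (trans (flip-edge s') (cong edge (sym (D-flip-D s')))))
    }
    where
      mirrored : Σ (ℕ → V) λ v → IsZigzag T v × Mirror v w (4 + m)
      mirrored = reflection zw (4 + m)
      mir : Mirror (proj₁ mirrored) w (4 + m)
      mir = proj₂ (proj₂ mirrored)

  private
    mirror-time : ∀ j o → suc (2 + j + (2 + o)) ≡ 4 + (suc j + o)
    mirror-time = solve-∀

  -- Part (1) for passages: the reversed zigzag is a passage from flip (D s')
  -- to flip (D s₀), its edges strictly between being reverses of edges of p.
  passage-reverse : ∀ {s₀ s'} → Passage s₀ s' → Passage (flip (D s')) (flip (D s₀))
  passage-reverse {s₀} {s'} p@(passage _ _ _ start₁ m _ outside) =
    passage v v-zigzag v-start₀ v-start₁ m v-return v-outside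
    where
      open Reversed (reversal p)
      v-return : edgeAt T v (2 + m) ≡ edge (flip (D s₀))
      v-return = trans (mirror-edge mirror (2 + m) 1 (cong (3 +_) (+-comm m 1)))
                   (trans (cong (rev T) start₁) (flip-edge (D s₀)))
      v-outside : ∀ j → j < m → ¬ Ω (edgeAt T v (2 + j))
      v-outside j j<m ω with m≤n⇒∃[o]m+o≡n j<m
      ... | o , 1+j+o≡m =
        outside o (subst (o <_) 1+j+o≡m (m<n+m o (s≤s z≤n)))
          (Ω-rev (subst Ω (mirror-edge mirror (2 + j) (2 + o) (trans (mirror-time j o) (cong (4 +_) 1+j+o≡m))) ω))

  -- Part (3) for passages: returning along flip (D s₀) would make the
  -- reversed zigzag start like w, so w would be its own mirror image.
  passage-not-flip : ∀ {s₀ s'} → Passage s₀ s' → s' ≢ flip (D s₀)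
  passage-not-flip {s₀} p@(passage w zw start₀ start₁ m _ _) refl =
    no-palindrome zw (2 + m) (λ k i k+i≡ → trans (sym (same-walk k)) (mirror k i k+i≡))
    where
      open Reversed (reversal p)
      back-to-start : flip (D (flip (D s₀))) ≡ s₀
      back-to-start = trans (cong flip (D-flip-D s₀)) (flip-involutive s₀)
      same-walk : ∀ t → v t ≡ w t
      same-walk = edges-determine v-zigzag zw
        (trans v-start₀ (trans (cong edge back-to-start) (sym start₀)))
        (trans v-start₁ (trans (cong (edge ∘ D) back-to-start) (sym start₁)))

  -- The monodromy as a map on arcs: mono s is the return arc of the passage
  -- leaving F along s, i.e. starting from D (D s), whose image under D is s.
  mono : Arc → Arc
  mono s = proj₁ (passage-exists (D (D s)))

  mono-passage : ∀ s → Passage (D (D s)) (mono s)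
  mono-passage s = proj₂ (passage-exists (D (D s)))

  mono-MF : ∀ s → MF T a b c (edge s) (edge (mono s))
  mono-MF s = subst (λ x → MF T a b c (edge x) (edge (mono s))) (D³ s) (passage-MF (mono-passage s))

  MF-mono : ∀ s {e'} → MF T a b c (edge s) e' → e' ≡ edge (mono s)
  MF-mono s {e'} p = from-passage (MF-passage p)
    where
      from-passage : (Σ Arc λ s₀ → Σ Arc λ s' → edge s ≡ edge (D s₀) × e' ≡ edge s' × Passage s₀ s') →
                     e' ≡ edge (mono s)
      from-passage (s₀ , s' , s≡ , e'≡ , q) =
        trans e'≡ (cong edge (passage-unique q (subst (λ x → Passage x (mono s)) D²s≡s₀ (mono-passage s))))
        where
          D²s≡s₀ : D (D s) ≡ s₀
          D²s≡s₀ = trans (cong (D ∘ D) (edge-injective s≡)) (D³ s₀)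

  MF-functional : ∀ {e e₁ e₂} → MF T a b c e e₁ → MF T a b c e e₂ → e₁ ≡ e₂
  MF-functional p q with arc-of (proj₁ p)
  ... | s , refl = trans (MF-mono s p) (sym (MF-mono s q))

  MF-reverse : ∀ {e e'} → MF T a b c e e' → MF T a b c (rev T e') (rev T e)
  MF-reverse p with MF-passage p
  ... | s₀ , s' , refl , refl , q =
    subst₂ (MF T a b c) (trans (cong edge (D-flip-D s')) (sym (flip-edge s'))) (sym (flip-edge (D s₀)))
      (passage-MF (passage-reverse q))

  MF-not-reverse : ∀ {e e'} → MF T a b c e e' → e' ≢ rev T e
  MF-not-reverse p with MF-passage p
  ... | s₀ , s' , refl , refl , q = λ eq → passage-not-flip q (edge-injective (trans eq (flip-edge (D s₀))))

  MF-total : ∀ e → Ω e → ∃[ e' ] MF T a b c e e'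
  MF-total e ω with arc-of ω
  ... | s , refl = edge (mono s) , mono-MF s

  -- surjectivity and injectivity are totality and functionality read through (1)
  MF-surjective : ∀ e' → Ω e' → ∃[ e ] MF T a b c e e'
  MF-surjective e' ω with MF-total (rev T e') (Ω-rev ω)
  ... | e , p = rev T e , MF-reverse p

  MF-injective : ∀ {e₁ e₂ e'} → MF T a b c e₁ e' → MF T a b c e₂ e' → e₁ ≡ e₂
  MF-injective p q = cong (rev T) (MF-functional (MF-reverse p) (MF-reverse q))

  -- (1) and (3) on arcs are the hypotheses of the short-cycle lemma
  mono-flip-mono : ∀ s → mono (flip (mono s)) ≡ flip s
  mono-flip-mono s = sym (edge-injective (MF-mono (flip (mono s))
    (subst₂ (MF T a b c) (flip-edge (mono s)) (flip-edge s) (MF-reverse (mono-MF s)))))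

  mono-not-flip : ∀ s → mono s ≢ flip s
  mono-not-flip s eq = MF-not-reverse (mono-MF s) (trans (cong edge eq) (sym (flip-edge s)))

  open ShortCycles flip flip-involutive flip-no-fixed side side-fibre mono mono-flip-mono mono-not-flip
    using (Cycle; short-cycle)

  MF-short-cycles : ∀ e → Ω e → Σ ℕ λ k → 1 ≤ k × k ≤ 3 × MFIter T a b c k e e
  MF-short-cycles e ω with arc-of ω
  ... | s , refl = cycle-of (short-cycle s)
    where
      cycle-of : Cycle s → Σ ℕ λ k → 1 ≤ k × k ≤ 3 × MFIter T a b c k (edge s) (edge s)
      cycle-of (inj₁ f¹s≡s) =
        1 , s≤s z≤n , s≤s z≤n ,
        edge (mono s) , mono-MF s , cong edge f¹s≡s
      cycle-of (inj₂ (inj₁ f²s≡s)) =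
        2 , s≤s z≤n , s≤s (s≤s z≤n) ,
        edge (mono s) , mono-MF s , edge (mono (mono s)) , mono-MF (mono s) , cong edge f²s≡s
      cycle-of (inj₂ (inj₂ f³s≡s)) =
        3 , s≤s z≤n , s≤s (s≤s (s≤s z≤n)) ,
        edge (mono s) , mono-MF s , edge (mono (mono s)) , mono-MF (mono s) ,
        edge (mono (mono (mono s))) , mono-MF (mono (mono s)) , cong edge f³s≡s

lemma4 : (T : Triangulation) → (a b c : Fin' T) → Triangulation.Face T a b c →
    -- (1)
    (∀ e e' → MF T a b c e e' → MF T a b c (rev T e') (rev T e)) ×
    -- (2) M_F is a well-defined bijection of Ω(F)
    ((∀ e → _∈Ω[_,_,_] T e a b c → ∃[ e' ] MF T a b c e e') ×
     (∀ e e₁ e₂ → MF T a b c e e₁ → MF T a b c e e₂ → e₁ ≡ e₂) ×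
     (∀ e' → _∈Ω[_,_,_] T e' a b c → ∃[ e ] MF T a b c e e') ×
     (∀ e₁ e₂ e' → MF T a b c e₁ e' → MF T a b c e₂ e' → e₁ ≡ e₂)) ×
    -- (3)
    (∀ e e' → MF T a b c e e' → e' ≢ rev T e) ×
    -- (4) every cycle of M_F has length at most 3
    (∀ e → _∈Ω[_,_,_] T e a b c →
       Σ ℕ λ k → 1 ≤ k × k ≤ 3 × MFIter T a b c k e e)
lemma4 T a b c abc =
  (λ _ _ → MF-reverse) ,
  (MF-total , (λ _ _ _ → MF-functional) , MF-surjective , (λ _ _ _ → MF-injective)) ,
  (λ _ _ → MF-not-reverse) ,
  MF-short-cycles
  where open Monodromy T a b c abc
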